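{- In the setting below, if $m>M_1$ then $s_m>0$. More precisely, $$s_m\ge\begin{cases}\mu\omega^2+\dfrac{m-M_1-1/2}{6q},&\text{if }\omega>0,\\[1.5ex] \dfrac{m-M_1-1/2}{6q},&\text{if }-N\le\omega\le0,\\[1.5ex] \mu(\omega+N)^2+\dfrac{m-M_1-1/2}{6q},&\text{if }\omega<-N.\end{cases}$$
   Context: Setting: $N$ a positive integer, $q$ a positive integer, $\alpha,\beta$ real, $\mu>0$, $f(x):=\mu x^3+\beta x^2+\alpha x$, $[x]:=\lfloor x+1/2\rfloor$, $m$ an integer. $\omega:=\beta/(3\mu)$, $s_m:=\mu\omega^2+\frac{m/2-q\alpha}{3q}$, $M_1:=[2q\min_{0\le x\le N}f'(x)]$. -}

module Defs where

open import Level using (Level; suc; _⊔_)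
open import Data.Nat as ℕ using (ℕ)
open import Data.Integer as ℤ using (ℤ; +_; -[1+_])
open import Data.Product using (_×_; Σ)
open import Relation.Binary.PropositionalEquality using (_≡_; _≢_)
open import Relation.Binary.Structures using (IsTotalOrder)
open import Algebra.Structures using (IsCommutativeRing)

natCast : ∀ {a} {A : Set a} → A → A → (A → A → A) → ℕ → A
natCast z o p ℕ.zero    = z
natCast z o p (ℕ.suc n) = p o (natCast z o p n)

intCast : ∀ {a} {A : Set a} → A → A → (A → A → A) → (A → A) → ℤ → A
intCast z o p n (+ k)    = natCast z o p k
intCast z o p n -[1+ k ] = n (natCast z o p (ℕ.suc k))

-- An ordered field equipped with a floor function (e.g. ℝ, ℚ).
-- The statement is proved for every such structure, in particular for ℝ.
record FloorOrderedField c ℓ : Set (Level.suc (c ⊔ ℓ)) where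
  infixl 7 _*_
  infixl 6 _+_ _-_
  infix  4 _≤_ _<_
  field
    Carrier : Set c
    _+_ _*_ : Carrier → Carrier → Carrier
    -_      : Carrier → Carrier
    _⁻¹     : Carrier → Carrier
    0# 1#   : Carrier
    _≤_     : Carrier → Carrier → Set ℓ
    isCommutativeRing : IsCommutativeRing _≡_ _+_ _*_ -_ 0# 1#
    0≢1     : 0# ≢ 1#
    ⁻¹-inverse : ∀ x → x ≢ 0# → x * (x ⁻¹) ≡ 1#
    isTotalOrder : IsTotalOrder _≡_ _≤_
    +-monoˡ-≤ : ∀ {x y} z → x ≤ y → x + z ≤ y + z
    *-nonneg  : ∀ {x y} → 0# ≤ x → 0# ≤ y → 0# ≤ x * y
    ⌊_⌋     : Carrier → ℤ

  _-_ : Carrier → Carrier → Carrier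
  x - y = x + (- y)

  _<_ : Carrier → Carrier → Set (c ⊔ ℓ)
  x < y = (x ≤ y) × (x ≢ y)

  fromℕ : ℕ → Carrier
  fromℕ = natCast 0# 1# _+_

  fromℤ : ℤ → Carrier
  fromℤ = intCast 0# 1# _+_ (λ x → - x)

  field
    floor-≤ : ∀ x → fromℤ ⌊ x ⌋ ≤ x
    floor-> : ∀ x → x < fromℤ (⌊ x ⌋ ℤ.+ + 1)

  round : Carrier → ℤ
  round x = ⌊ x + (fromℕ 2) ⁻¹ ⌋

  sq : Carrier → Carrier
  sq x = x * x

  f : (μ β α : Carrier) → Carrier → Carrier
  f μ β α x = μ * (x * x * x) + β * (x * x) + α * x

  f′ : (μ β α : Carrier) → Carrier → Carrier
  f′ μ β α x = fromℕ 3 * μ * (x * x) + fromℕ 2 * β * x + α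

  ω : (μ β : Carrier) → Carrier
  ω μ β = β * (fromℕ 3 * μ) ⁻¹

  s : (q : ℕ) (μ β α : Carrier) (m : ℤ) → Carrier
  s q μ β α m = μ * sq (ω μ β) + (fromℤ m * (fromℕ 2) ⁻¹ - fromℕ q * α) * (fromℕ 3 * fromℕ q) ⁻¹

  IsMinOn : (N : ℕ) (g : Carrier → Carrier) (v : Carrier) → Set (c ⊔ ℓ)
  IsMinOn N g v = Σ Carrier (λ x₀ → (0# ≤ x₀) × (x₀ ≤ fromℕ N) × (g x₀ ≡ v))
                × (∀ x → 0# ≤ x → x ≤ fromℕ N → v ≤ g x)

  -- M₁ = [2q · min_{0≤x≤N} f'(x)], given the minimum value v
  M₁ : (q : ℕ) (v : Carrier) → ℤ
  M₁ q v = round (fromℕ 2 * fromℕ q * v)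

  gap : (q : ℕ) (m M : ℤ) → Carrier
  gap q m M = (fromℤ (m ℤ.- M) - (fromℕ 2) ⁻¹) * (fromℕ 6 * fromℕ q) ⁻¹

{-# OPTIONS --safe #-}

-- Write β = 3μω and v = f′(x₀) with x₀ ∈ [0, N]. Completing the square,
-- f′(x) = 3μ(x + ω)² + α − 3μω², turns s_m into (m − 2qv)/(6q) + μ(x₀ + ω)².
-- Since M₁ = [2qv] ≥ 2qv − 1/2, the first summand is at least (m − M₁ − 1/2)/(6q),
-- which is positive once m > M₁. In the three cases μ(x₀ + ω)² is at least
-- μω² (as x₀ + ω ≥ ω ≥ 0), 0, and μ(ω + N)² (as x₀ + ω ≤ ω + N < 0).
module Submission where

open import Defs
open import Data.Nat as ℕ using (ℕ)
open import Data.Integer as ℤ using (ℤ; -[1+_]; _⊖_)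
import Data.Nat.Properties as ℕᵖ
import Data.Integer.Properties as ℤᵖ
open import Data.Maybe using (Maybe; just; nothing)
open import Data.Product using (_×_; _,_; proj₁)
open import Data.Sum using (inj₁; inj₂)
open import Data.Empty using (⊥-elim)
open import Relation.Nullary using (yes; no)
open import Relation.Binary.PropositionalEquality
open import Relation.Binary.Structures using (IsTotalOrder)
open import Algebra.Bundles using (CommutativeRing)
open import Algebra.Structures using (IsCommutativeRing)
import Algebra.Properties.Ring as RingProperties
import Algebra.Properties.AbelianGroup as AbelianGroupProperties
import Algebra.Properties.CommutativeSemigroup as CommutativeSemigroupProperties
open import Algebra.Solver.Ring.AlmostCommutativeRing
  using (_-Raw-AlmostCommutative⟶_; fromCommutativeRing)

module FieldArithmetic {c ℓ} (F : FloorOrderedField c ℓ) where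
  open FloorOrderedField F
  open IsCommutativeRing isCommutativeRing
    using (+-assoc; +-comm; +-identityˡ; +-identityʳ; -‿inverseʳ; distribʳ; *-identityˡ; zeroˡ)

  commutativeRing : CommutativeRing c c
  commutativeRing = record { isCommutativeRing = isCommutativeRing }

  open CommutativeRing commutativeRing using (ring; +-abelianGroup; +-commutativeSemigroup)
  open RingProperties ring using (-0#≈0#; -‿involutive; -‿distribˡ-*)
  open AbelianGroupProperties +-abelianGroup using (⁻¹-∙-comm)
  open CommutativeSemigroupProperties +-commutativeSemigroup using (interchange)
  open ≡-Reasoning

  fromℕ-+ : ∀ a b → fromℕ (a ℕ.+ b) ≡ fromℕ a + fromℕ b
  fromℕ-+ ℕ.zero    b = sym (+-identityˡ _)
  fromℕ-+ (ℕ.suc a) b = trans (cong (1# +_) (fromℕ-+ a b)) (sym (+-assoc 1# _ _))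

  fromℤ-⊖ : ∀ a b → fromℤ (a ⊖ b) ≡ fromℕ a - fromℕ b
  fromℤ-⊖ ℕ.zero    ℕ.zero    = sym (-‿inverseʳ 0#)
  fromℤ-⊖ ℕ.zero    (ℕ.suc b) = sym (+-identityˡ _)
  fromℤ-⊖ (ℕ.suc a) ℕ.zero    = sym (trans (cong (fromℕ (ℕ.suc a) +_) -0#≈0#) (+-identityʳ _))
  fromℤ-⊖ (ℕ.suc a) (ℕ.suc b) = begin
    fromℤ (ℕ.suc a ⊖ ℕ.suc b)           ≡⟨ cong fromℤ (ℤᵖ.[1+m]⊖[1+n]≡m⊖n a b) ⟩
    fromℤ (a ⊖ b)                       ≡⟨ fromℤ-⊖ a b ⟩
    fromℕ a - fromℕ b                   ≡⟨ +-identityˡ _ ⟨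
    0# + (fromℕ a - fromℕ b)            ≡⟨ cong (_+ (fromℕ a - fromℕ b)) (-‿inverseʳ 1#) ⟨
    (1# - 1#) + (fromℕ a - fromℕ b)     ≡⟨ interchange 1# (- 1#) (fromℕ a) (- fromℕ b) ⟩
    (1# + fromℕ a) + (- 1# - fromℕ b)   ≡⟨ cong ((1# + fromℕ a) +_) (⁻¹-∙-comm 1# (fromℕ b)) ⟩
    fromℕ (ℕ.suc a) - fromℕ (ℕ.suc b)   ∎

  fromℤ-+ : ∀ i j → fromℤ (i ℤ.+ j) ≡ fromℤ i + fromℤ j
  fromℤ-+ (ℤ.+ a)  (ℤ.+ b)  = fromℕ-+ a b
  fromℤ-+ (ℤ.+ a)  -[1+ b ] = fromℤ-⊖ a (ℕ.suc b)
  fromℤ-+ -[1+ a ] (ℤ.+ b)  = trans (fromℤ-⊖ b (ℕ.suc a)) (+-comm _ _)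
  fromℤ-+ -[1+ a ] -[1+ b ] = begin
    - fromℕ (ℕ.suc (ℕ.suc (a ℕ.+ b)))           ≡⟨ cong (λ n → - fromℕ (ℕ.suc n)) (ℕᵖ.+-suc a b) ⟨
    - fromℕ (ℕ.suc a ℕ.+ ℕ.suc b)               ≡⟨ cong -_ (fromℕ-+ (ℕ.suc a) (ℕ.suc b)) ⟩
    - (fromℕ (ℕ.suc a) + fromℕ (ℕ.suc b))       ≡⟨ ⁻¹-∙-comm _ _ ⟨
    - fromℕ (ℕ.suc a) + - fromℕ (ℕ.suc b)       ∎

  fromℤ-neg : ∀ i → fromℤ (ℤ.- i) ≡ - fromℤ i
  fromℤ-neg (ℤ.+ ℕ.zero)  = sym -0#≈0#
  fromℤ-neg (ℤ.+ ℕ.suc _) = refl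
  fromℤ-neg -[1+ _ ]     = sym (-‿involutive _)

  fromℤ-*ℕ : ∀ a j → fromℤ (ℤ.+ a ℤ.* j) ≡ fromℕ a * fromℤ j
  fromℤ-*ℕ ℕ.zero    j = trans (cong fromℤ (ℤᵖ.*-zeroˡ j)) (sym (zeroˡ _))
  fromℤ-*ℕ (ℕ.suc a) j = begin
    fromℤ (ℤ.+ ℕ.suc a ℤ.* j)          ≡⟨ cong fromℤ (ℤᵖ.suc-* (ℤ.+ a) j) ⟩
    fromℤ (j ℤ.+ ℤ.+ a ℤ.* j)          ≡⟨ fromℤ-+ j _ ⟩
    fromℤ j + fromℤ (ℤ.+ a ℤ.* j)      ≡⟨ cong₂ _+_ (sym (*-identityˡ _)) (fromℤ-*ℕ a j) ⟩
    1# * fromℤ j + fromℕ a * fromℤ j   ≡⟨ distribʳ _ _ _ ⟨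
    fromℕ (ℕ.suc a) * fromℤ j          ∎

  fromℤ-* : ∀ i j → fromℤ (i ℤ.* j) ≡ fromℤ i * fromℤ j
  fromℤ-* (ℤ.+ a)  j = fromℤ-*ℕ a j
  fromℤ-* -[1+ a ] j = begin
    fromℤ (-[1+ a ] ℤ.* j)            ≡⟨ cong fromℤ (ℤᵖ.neg-distribˡ-* (ℤ.+ ℕ.suc a) j) ⟨
    fromℤ (ℤ.- (ℤ.+ ℕ.suc a ℤ.* j))   ≡⟨ fromℤ-neg (ℤ.+ ℕ.suc a ℤ.* j) ⟩
    - fromℤ (ℤ.+ ℕ.suc a ℤ.* j)       ≡⟨ cong -_ (fromℤ-*ℕ (ℕ.suc a) j) ⟩
    - (fromℕ (ℕ.suc a) * fromℤ j)     ≡⟨ -‿distribˡ-* _ _ ⟩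
    - fromℕ (ℕ.suc a) * fromℤ j       ∎

  fromℤ-homomorphism : ℤ.+-*-rawRing -Raw-AlmostCommutative⟶ fromCommutativeRing commutativeRing
  fromℤ-homomorphism = record
    { ⟦_⟧ = fromℤ ; +-homo = fromℤ-+ ; *-homo = fromℤ-* ; -‿homo = fromℤ-neg
    ; 0-homo = refl ; 1-homo = +-identityʳ 1# }

  fromℤ-≟ : ∀ i j → Maybe (fromℤ i ≡ fromℤ j)
  fromℤ-≟ i j with i ℤ.≟ j
  ... | yes refl = just refl
  ... | no _     = nothing

  fromℤ-- : ∀ i j → fromℤ (i ℤ.- j) ≡ fromℤ i - fromℤ j
  fromℤ-- i j = trans (fromℤ-+ i (ℤ.- j)) (cong (fromℤ i +_) (fromℤ-neg j))

  open import Algebra.Solver.Ring ℤ.+-*-rawRing (fromCommutativeRing commutativeRing) fromℤ-homomorphism fromℤ-≟ public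

module OrderedFieldProperties {c ℓ} (F : FloorOrderedField c ℓ) where
  open FloorOrderedField F
  open FieldArithmetic F
  open IsCommutativeRing isCommutativeRing
    using (+-comm; +-identityˡ; +-identityʳ; -‿inverseʳ; *-identityʳ; *-comm; zeroʳ)
  module ≤ = IsTotalOrder isTotalOrder
  open ≡-Reasoning

  ⁻¹-unique : ∀ {x y} → x * y ≡ 1# → y ≡ x ⁻¹
  ⁻¹-unique {x} {y} xy≡1 = begin
    y                    ≡⟨ *-identityʳ y ⟨
    y * 1#               ≡⟨ cong (y *_) (⁻¹-inverse x x≢0) ⟨
    y * (x * x ⁻¹)       ≡⟨ solve 3 (λ x y x⁻¹ → y :* (x :* x⁻¹) := (x :* y) :* x⁻¹) refl x y (x ⁻¹) ⟩
    (x * y) * x ⁻¹       ≡⟨ cong (_* x ⁻¹) xy≡1 ⟩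
    1# * x ⁻¹            ≡⟨ trans (*-comm 1# _) (*-identityʳ _) ⟩
    x ⁻¹                 ∎
    where
    x≢0 : x ≢ 0#
    x≢0 x≡0 = 0≢1 (begin
      0#      ≡⟨ solve 1 (λ y → con (ℤ.+ 0) := con (ℤ.+ 0) :* y) refl y ⟩
      0# * y  ≡⟨ cong (_* y) x≡0 ⟨
      x * y   ≡⟨ xy≡1 ⟩
      1#      ∎)

  x*[y*x⁻¹]≡y : ∀ {x} y → x ≢ 0# → x * (y * x ⁻¹) ≡ y
  x*[y*x⁻¹]≡y {x} y x≢0 = begin
    x * (y * x ⁻¹)   ≡⟨ solve 3 (λ x y x⁻¹ → x :* (y :* x⁻¹) := y :* (x :* x⁻¹)) refl x y (x ⁻¹) ⟩
    y * (x * x ⁻¹)   ≡⟨ cong (y *_) (⁻¹-inverse x x≢0) ⟩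
    y * 1#           ≡⟨ *-identityʳ y ⟩
    y                ∎

  +-monoʳ-≤ : ∀ z {x y} → x ≤ y → z + x ≤ z + y
  +-monoʳ-≤ z {x} {y} x≤y = subst₂ _≤_ (+-comm x z) (+-comm y z) (+-monoˡ-≤ z x≤y)

  +-cancelʳ-≤ : ∀ z {x y} → x + z ≤ y + z → x ≤ y
  +-cancelʳ-≤ z {x} {y} h = subst₂ _≤_ (x+z-z≡x x) (x+z-z≡x y) (+-monoˡ-≤ (- z) h)
    where
    x+z-z≡x : ∀ x → x + z - z ≡ x
    x+z-z≡x x = solve 2 (λ x z → x :+ z :- z := x) refl x z

  x≤y⇒0≤y-x : ∀ {x y} → x ≤ y → 0# ≤ y - x
  x≤y⇒0≤y-x {x} x≤y = subst (_≤ _) (-‿inverseʳ x) (+-monoˡ-≤ (- x) x≤y)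

  0≤y-x⇒x≤y : ∀ {x y} → 0# ≤ y - x → x ≤ y
  0≤y-x⇒x≤y {x} {y} h = +-cancelʳ-≤ (- x) (subst₂ _≤_ (sym (-‿inverseʳ x)) refl h)

  0≤p⇒x≤p+x : ∀ {p} x → 0# ≤ p → x ≤ p + x
  0≤p⇒x≤p+x x 0≤p = subst (_≤ _ + x) (+-identityˡ x) (+-monoˡ-≤ x 0≤p)

  neg-antimono-≤ : ∀ {x y} → x ≤ y → - y ≤ - x
  neg-antimono-≤ {x} {y} x≤y = 0≤y-x⇒x≤y (subst (0# ≤_) y-x≡-x+y (x≤y⇒0≤y-x x≤y))
    where
    y-x≡-x+y : y - x ≡ - x - - y
    y-x≡-x+y = solve 2 (λ x y → y :- x := :- x :- :- y) refl x y

  *-monoˡ-≤-nonNeg : ∀ {z x y} → 0# ≤ z → x ≤ y → z * x ≤ z * y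
  *-monoˡ-≤-nonNeg {z} {x} {y} 0≤z x≤y =
    0≤y-x⇒x≤y (subst (0# ≤_) distrib (*-nonneg 0≤z (x≤y⇒0≤y-x x≤y)))
    where
    distrib : z * (y - x) ≡ z * y - z * x
    distrib = solve 3 (λ z x y → z :* (y :- x) := z :* y :- z :* x) refl z x y

  *-monoʳ-≤-nonNeg : ∀ {z x y} → 0# ≤ z → x ≤ y → x * z ≤ y * z
  *-monoʳ-≤-nonNeg {z} {x} {y} 0≤z x≤y = subst₂ _≤_ (*-comm z x) (*-comm z y) (*-monoˡ-≤-nonNeg 0≤z x≤y)

  x≤0⇒0≤-x : ∀ {x} → x ≤ 0# → 0# ≤ - x
  x≤0⇒0≤-x {x} x≤0 = subst (_≤ - x) (solve 0 (:- con (ℤ.+ 0) := con (ℤ.+ 0)) refl) (neg-antimono-≤ x≤0)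

  sq-neg : ∀ x → sq (- x) ≡ sq x
  sq-neg x = solve 1 (λ x → :- x :* :- x := x :* x) refl x

  0≤sq : ∀ x → 0# ≤ sq x
  0≤sq x with ≤.total 0# x
  ... | inj₁ 0≤x = *-nonneg 0≤x 0≤x
  ... | inj₂ x≤0 = subst (0# ≤_) (sq-neg x) (*-nonneg (x≤0⇒0≤-x x≤0) (x≤0⇒0≤-x x≤0))

  sq-mono-≤-nonNeg : ∀ {x y} → 0# ≤ x → x ≤ y → sq x ≤ sq y
  sq-mono-≤-nonNeg {x} {y} 0≤x x≤y =
    0≤y-x⇒x≤y (subst (0# ≤_) difference-of-squares (*-nonneg (x≤y⇒0≤y-x x≤y) 0≤y+x))
    where
    0≤y+x : 0# ≤ y + x
    0≤y+x = ≤.trans 0≤x (0≤p⇒x≤p+x x (≤.trans 0≤x x≤y))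
    difference-of-squares : (y - x) * (y + x) ≡ y * y - x * x
    difference-of-squares = solve 2 (λ x y → (y :- x) :* (y :+ x) := y :* y :- x :* x) refl x y

  sq-antimono-≤-nonPos : ∀ {x y} → x ≤ y → y ≤ 0# → sq y ≤ sq x
  sq-antimono-≤-nonPos {x} {y} x≤y y≤0 =
    subst₂ _≤_ (sq-neg y) (sq-neg x) (sq-mono-≤-nonNeg (x≤0⇒0≤-x y≤0) (neg-antimono-≤ x≤y))

  0≤1 : 0# ≤ 1#
  0≤1 = subst (0# ≤_) (*-identityʳ 1#) (0≤sq 1#)

  0≤fromℕ : ∀ n → 0# ≤ fromℕ n
  0≤fromℕ ℕ.zero    = ≤.refl
  0≤fromℕ (ℕ.suc n) = ≤.trans (0≤fromℕ n) (0≤p⇒x≤p+x _ 0≤1)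

  0≤fromℤ : ∀ {i} → ℤ.0ℤ ℤ.≤ i → 0# ≤ fromℤ i
  0≤fromℤ {ℤ.+ n} _ = 0≤fromℕ n

  fromℤ-mono-≤ : ∀ {i j} → i ℤ.≤ j → fromℤ i ≤ fromℤ j
  fromℤ-mono-≤ {i} {j} i≤j = 0≤y-x⇒x≤y (subst (0# ≤_) (fromℤ-- j i) (0≤fromℤ (ℤᵖ.i≤j⇒0≤j-i i≤j)))

  <-≤-trans : ∀ {x y z} → x < y → y ≤ z → x < z
  <-≤-trans (x≤y , x≢y) y≤z =
    ≤.trans x≤y y≤z , λ { refl → x≢y (≤.antisym x≤y y≤z) }

  0<x⇒x≢0 : ∀ {x} → 0# < x → x ≢ 0#
  0<x⇒x≢0 (_ , 0≢x) x≡0 = 0≢x (sym x≡0)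

  0<fromℕ[1+n] : ∀ n → 0# < fromℕ (ℕ.suc n)
  0<fromℕ[1+n] n = <-≤-trans (0≤1 , 0≢1) 1≤1+n
    where
    1≤1+n : 1# ≤ 1# + fromℕ n
    1≤1+n = subst (_≤ 1# + fromℕ n) (+-identityʳ 1#) (+-monoʳ-≤ 1# (0≤fromℕ n))

  *-pos : ∀ {x y} → 0# < x → 0# < y → 0# < x * y
  *-pos {x} {y} 0<x 0<y@(0≤y , _) = *-nonneg (proj₁ 0<x) 0≤y , λ 0≡xy → 0<x⇒x≢0 0<y (y≡0 0≡xy)
    where
    y≡0 : 0# ≡ x * y → y ≡ 0#
    y≡0 0≡xy = begin
      y                  ≡⟨ x*[y*x⁻¹]≡y y (0<x⇒x≢0 0<x) ⟨
      x * (y * x ⁻¹)     ≡⟨ solve 3 (λ x y x⁻¹ → x :* (y :* x⁻¹) := (x :* y) :* x⁻¹) refl x y (x ⁻¹) ⟩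
      (x * y) * x ⁻¹     ≡⟨ cong (_* x ⁻¹) 0≡xy ⟨
      0# * x ⁻¹          ≡⟨ solve 1 (λ z → con (ℤ.+ 0) :* z := con (ℤ.+ 0)) refl (x ⁻¹) ⟩
      0#                 ∎

  ⁻¹-pos : ∀ {x} → 0# < x → 0# < x ⁻¹
  ⁻¹-pos {x} 0<x@(0≤x , _) = 0≤x⁻¹ , λ 0≡x⁻¹ → 0≢1 (begin
    0#          ≡⟨ zeroʳ x ⟨
    x * 0#      ≡⟨ cong (x *_) 0≡x⁻¹ ⟩
    x * x ⁻¹    ≡⟨ ⁻¹-inverse x x≢0 ⟩
    1#          ∎)
    where
    x≢0 : x ≢ 0#
    x≢0 = 0<x⇒x≢0 0<x
    0≤x⁻¹ : 0# ≤ x ⁻¹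
    0≤x⁻¹ with ≤.total 0# (x ⁻¹)
    ... | inj₁ 0≤x⁻¹ = 0≤x⁻¹
    ... | inj₂ x⁻¹≤0 = ⊥-elim (0≢1 (≤.antisym 0≤1 1≤0))
      where
      1≤0 : 1# ≤ 0#
      1≤0 = subst₂ _≤_ (⁻¹-inverse x x≢0) (zeroʳ x) (*-monoˡ-≤-nonNeg 0≤x x⁻¹≤0)

module SmLowerBound {c ℓ} (F : FloorOrderedField c ℓ) where
  open FloorOrderedField F
  open FieldArithmetic F
  open OrderedFieldProperties F
  open IsCommutativeRing isCommutativeRing using (+-comm; +-assoc; +-identityʳ)
  open ≡-Reasoning

  ½ : Carrier
  ½ = fromℕ 2 ⁻¹

  [6q]⁻¹ : ℕ → Carrier
  [6q]⁻¹ q = (fromℕ 6 * fromℕ q) ⁻¹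

  0<½ : 0# < ½
  0<½ = ⁻¹-pos (0<fromℕ[1+n] 1)

  2*½≡1 : fromℕ 2 * ½ ≡ fromℕ 1
  2*½≡1 = trans (⁻¹-inverse _ (0<x⇒x≢0 (0<fromℕ[1+n] 1))) (sym (+-identityʳ 1#))

  ½+½≡1 : ½ + ½ ≡ fromℕ 1
  ½+½≡1 = trans (solve 1 (λ h → h :+ h := con (ℤ.+ 2) :* h) refl ½) 2*½≡1

  round-≤ : ∀ x → x ≤ fromℤ (round x) + ½
  round-≤ x = +-cancelʳ-≤ ½ (subst (x + ½ ≤_) ⌊x+½⌋+1≡ (proj₁ (floor-> (x + ½))))
    where
    ⌊x+½⌋+1≡ : fromℤ (round x ℤ.+ ℤ.+ 1) ≡ fromℤ (round x) + ½ + ½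
    ⌊x+½⌋+1≡ = begin
      fromℤ (round x ℤ.+ ℤ.+ 1)    ≡⟨ fromℤ-+ (round x) (ℤ.+ 1) ⟩
      fromℤ (round x) + fromℕ 1    ≡⟨ cong (fromℤ (round x) +_) ½+½≡1 ⟨
      fromℤ (round x) + (½ + ½)    ≡⟨ +-assoc _ ½ ½ ⟨
      fromℤ (round x) + ½ + ½      ∎

  0<6q : ∀ {q} → 1 ℕ.≤ q → 0# < fromℕ 6 * fromℕ q
  0<6q {ℕ.suc q} _ = *-pos (0<fromℕ[1+n] 5) (0<fromℕ[1+n] q)

  0<[6q]⁻¹ : ∀ {q} → 1 ℕ.≤ q → 0# < [6q]⁻¹ q
  0<[6q]⁻¹ q≥1 = ⁻¹-pos (0<6q q≥1)

  gap≡ : ∀ q m M → gap q m M ≡ (fromℤ m - (fromℤ M + ½)) * [6q]⁻¹ q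
  gap≡ q m M = begin
    (fromℤ (m ℤ.- M) - ½) * [6q]⁻¹ q          ≡⟨ cong (λ t → (t - ½) * [6q]⁻¹ q) (fromℤ-- m M) ⟩
    (fromℤ m - fromℤ M - ½) * [6q]⁻¹ q        ≡⟨ solve 4 (λ m̂ M̂ h κ → (m̂ :- M̂ :- h) :* κ := (m̂ :- (M̂ :+ h)) :* κ)
                                                    refl (fromℤ m) (fromℤ M) ½ ([6q]⁻¹ q) ⟩
    (fromℤ m - (fromℤ M + ½)) * [6q]⁻¹ q      ∎

  gap-≤ : ∀ {q m M y} → 1 ℕ.≤ q → y ≤ fromℤ M + ½ → gap q m M ≤ (fromℤ m - y) * [6q]⁻¹ q
  gap-≤ {q} {m} {M} {y} q≥1 y≤M+½ = subst (_≤ (fromℤ m - y) * [6q]⁻¹ q) (sym (gap≡ q m M))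
    (*-monoʳ-≤-nonNeg (proj₁ (0<[6q]⁻¹ q≥1)) (+-monoʳ-≤ (fromℤ m) (neg-antimono-≤ y≤M+½)))

  gap-pos : ∀ {q m M} → 1 ℕ.≤ q → M ℤ.< m → 0# < gap q m M
  gap-pos {q} {m} {M} q≥1 M<m =
    subst (0# <_) (sym (gap≡ q m M)) (*-pos (<-≤-trans 0<½ ½≤m-M-½) (0<[6q]⁻¹ q≥1))
    where
    1+M≤m : fromℕ 1 + fromℤ M ≤ fromℤ m
    1+M≤m = subst (_≤ _) (fromℤ-+ (ℤ.+ 1) M) (fromℤ-mono-≤ (ℤᵖ.i<j⇒suc[i]≤j M<m))
    rearrange : fromℤ m - (fromℕ 1 + fromℤ M) ≡ fromℤ m - (fromℤ M + ½) - ½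
    rearrange = begin
      fromℤ m - (fromℕ 1 + fromℤ M)   ≡⟨ cong (λ t → fromℤ m - (t + fromℤ M)) ½+½≡1 ⟨
      fromℤ m - ((½ + ½) + fromℤ M)   ≡⟨ solve 3 (λ m̂ M̂ h → m̂ :- ((h :+ h) :+ M̂) := m̂ :- (M̂ :+ h) :- h)
                                           refl (fromℤ m) (fromℤ M) ½ ⟩
      fromℤ m - (fromℤ M + ½) - ½     ∎
    ½≤m-M-½ : ½ ≤ fromℤ m - (fromℤ M + ½)
    ½≤m-M-½ = 0≤y-x⇒x≤y (subst (0# ≤_) rearrange (x≤y⇒0≤y-x 1+M≤m))

  s≡ : ∀ q {μ} β α m x → 1 ℕ.≤ q → 0# < μ →
    s q μ β α m ≡ (fromℤ m - fromℕ 2 * fromℕ q * f′ μ β α x) * [6q]⁻¹ q + μ * sq (x + ω μ β)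
  s≡ q {μ} β α m x q≥1 0<μ = begin
    μ * sq w + (m̂ * ½ - Q * α) * (fromℕ 3 * Q) ⁻¹
      ≡⟨ cong (λ t → μ * sq w + (m̂ * ½ - Q * α) * t) [3q]⁻¹≡2κ ⟩
    μ * sq w + (m̂ * ½ - Q * α) * (fromℕ 2 * κ)
      ≡⟨ solve 7 (λ μ w m̂ h Q α κ →
           μ :* (w :* w) :+ (m̂ :* h :- Q :* α) :* (con (ℤ.+ 2) :* κ)
           := μ :* (w :* w) :+ (m̂ :* (con (ℤ.+ 2) :* h) :- con (ℤ.+ 2) :* Q :* α) :* κ)
         refl μ w m̂ ½ Q α κ ⟩
    μ * sq w + (m̂ * (fromℕ 2 * ½) - fromℕ 2 * Q * α) * κ
      ≡⟨ cong (λ t → μ * sq w + (m̂ * t - fromℕ 2 * Q * α) * κ) 2*½≡1 ⟩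
    μ * sq w + (m̂ * fromℕ 1 - fromℕ 2 * Q * α) * κ
      ≡⟨ solve 7 (λ μ w m̂ Q α κ x →
           μ :* (w :* w) :+ (m̂ :* con (ℤ.+ 1) :- con (ℤ.+ 2) :* Q :* α) :* κ
           := μ :* (w :* w) :+ (m̂ :- con (ℤ.+ 2) :* Q :* α) :* κ
              :+ μ :* (x :* x :+ con (ℤ.+ 2) :* w :* x)
              :- μ :* (x :* x :+ con (ℤ.+ 2) :* w :* x) :* con (ℤ.+ 1))
         refl μ w m̂ Q α κ x ⟩
    μ * sq w + (m̂ - fromℕ 2 * Q * α) * κ + T - T * fromℕ 1
      ≡⟨ cong (λ t → μ * sq w + (m̂ - fromℕ 2 * Q * α) * κ + T - T * t) 6Qκ≡1 ⟨
    μ * sq w + (m̂ - fromℕ 2 * Q * α) * κ + T - T * (fromℕ 6 * Q * κ)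
      ≡⟨ solve 7 (λ μ w m̂ Q α κ x →
           μ :* (w :* w) :+ (m̂ :- con (ℤ.+ 2) :* Q :* α) :* κ
           :+ μ :* (x :* x :+ con (ℤ.+ 2) :* w :* x)
           :- μ :* (x :* x :+ con (ℤ.+ 2) :* w :* x) :* (con (ℤ.+ 6) :* Q :* κ)
           := (m̂ :- con (ℤ.+ 2) :* Q
                    :* (con (ℤ.+ 3) :* μ :* (x :* x) :+ con (ℤ.+ 2) :* (con (ℤ.+ 3) :* μ :* w) :* x :+ α)) :* κ
              :+ μ :* ((x :+ w) :* (x :+ w)))
         refl μ w m̂ Q α κ x ⟩
    (m̂ - fromℕ 2 * Q * f′ μ (fromℕ 3 * μ * w) α x) * κ + μ * sq (x + w)
      ≡⟨ cong (λ b → (m̂ - fromℕ 2 * Q * f′ μ b α x) * κ + μ * sq (x + w)) 3μω≡β ⟩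
    (m̂ - fromℕ 2 * Q * f′ μ β α x) * κ + μ * sq (x + w)
      ∎
    where
    w = ω μ β
    Q = fromℕ q
    m̂ = fromℤ m
    κ = [6q]⁻¹ q
    T = μ * (x * x + fromℕ 2 * w * x)
    3μω≡β : fromℕ 3 * μ * w ≡ β
    3μω≡β = x*[y*x⁻¹]≡y β (0<x⇒x≢0 (*-pos (0<fromℕ[1+n] 2) 0<μ))
    6Qκ≡1 : fromℕ 6 * Q * κ ≡ fromℕ 1
    6Qκ≡1 = trans (⁻¹-inverse _ (0<x⇒x≢0 (0<6q q≥1))) (sym (+-identityʳ 1#))
    [3q]⁻¹≡2κ : (fromℕ 3 * Q) ⁻¹ ≡ fromℕ 2 * κ
    [3q]⁻¹≡2κ = sym (⁻¹-unique (begin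
      fromℕ 3 * Q * (fromℕ 2 * κ)   ≡⟨ solve 2 (λ Q κ → con (ℤ.+ 3) :* Q :* (con (ℤ.+ 2) :* κ)
                                                      := con (ℤ.+ 6) :* Q :* κ) refl Q κ ⟩
      fromℕ 6 * Q * κ               ≡⟨ 6Qκ≡1 ⟩
      fromℕ 1                       ≡⟨ +-identityʳ 1# ⟩
      1#                            ∎))

  s-lower-bound : ∀ q {μ} β α m x → 1 ℕ.≤ q → 0# < μ →
    μ * sq (x + ω μ β) + gap q m (M₁ q (f′ μ β α x)) ≤ s q μ β α m
  s-lower-bound q {μ} β α m x q≥1 0<μ =
    subst (μ * sq (x + ω μ β) + gap q m M ≤_) (trans (+-comm _ _) (sym (s≡ q β α m x q≥1 0<μ)))
      (+-monoʳ-≤ _ (gap-≤ {q} {m} {M} q≥1 (round-≤ _)))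
    where
    M = M₁ q (f′ μ β α x)

lemma8p4 : ∀ {c ℓ} (F : FloorOrderedField c ℓ) → let open FloorOrderedField F in
    (N q : ℕ) → 1 ℕ.≤ N → 1 ℕ.≤ q →
    (α β μ : Carrier) → 0# < μ → (m : ℤ) →
    (v : Carrier) → IsMinOn N (f′ μ β α) v →
    (M₁ q v ℤ.< m → 0# < s q μ β α m)
    × (0# < ω μ β → μ * sq (ω μ β) + gap q m (M₁ q v) ≤ s q μ β α m)
    × (- fromℕ N ≤ ω μ β → ω μ β ≤ 0# → gap q m (M₁ q v) ≤ s q μ β α m)
    × (ω μ β < - fromℕ N → μ * sq (ω μ β + fromℕ N) + gap q m (M₁ q v) ≤ s q μ β α m)
lemma8p4 F N q _ q≥1 α β μ 0<μ@(0≤μ , _) m v ((x₀ , 0≤x₀ , x₀≤N , f′x₀≡v) , _) =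
  s-pos , bound-ω>0 , bound-ω∈[-N,0] , bound-ω<-N
  where
  open FloorOrderedField F
  open OrderedFieldProperties F
  open SmLowerBound F
  open IsCommutativeRing isCommutativeRing using (+-comm; -‿inverseˡ)
  w = ω μ β
  G = gap q m (M₁ q v)

  bound : μ * sq (x₀ + w) + G ≤ s q μ β α m
  bound = subst (λ v → μ * sq (x₀ + w) + gap q m (M₁ q v) ≤ s q μ β α m) f′x₀≡v
            (s-lower-bound q β α m x₀ q≥1 0<μ)

  bound-via : ∀ {y} → sq y ≤ sq (x₀ + w) → μ * sq y + G ≤ s q μ β α m
  bound-via sqy≤ = ≤.trans (+-monoˡ-≤ G (*-monoˡ-≤-nonNeg 0≤μ sqy≤)) bound

  G≤s : G ≤ s q μ β α m
  G≤s = ≤.trans (0≤p⇒x≤p+x G (*-nonneg 0≤μ (0≤sq _))) bound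

  s-pos : M₁ q v ℤ.< m → 0# < s q μ β α m
  s-pos M<m = <-≤-trans (gap-pos q≥1 M<m) G≤s

  bound-ω>0 : 0# < w → μ * sq w + G ≤ s q μ β α m
  bound-ω>0 (0≤w , _) = bound-via (sq-mono-≤-nonNeg 0≤w (0≤p⇒x≤p+x w 0≤x₀))

  bound-ω∈[-N,0] : - fromℕ N ≤ w → w ≤ 0# → G ≤ s q μ β α m
  bound-ω∈[-N,0] _ _ = G≤s

  bound-ω<-N : w < - fromℕ N → μ * sq (w + fromℕ N) + G ≤ s q μ β α m
  bound-ω<-N (w≤-N , _) = bound-via (sq-antimono-≤-nonPos x₀+w≤w+N w+N≤0)
    where
    x₀+w≤w+N : x₀ + w ≤ w + fromℕ N
    x₀+w≤w+N = subst (x₀ + w ≤_) (+-comm _ _) (+-monoˡ-≤ w x₀≤N)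
    w+N≤0 : w + fromℕ N ≤ 0#
    w+N≤0 = subst (w + fromℕ N ≤_) (-‿inverseˡ _) (+-monoˡ-≤ (fromℕ N) w≤-N)
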